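{- Let $(x,y)\in\mathbb{Z}_{\geq0}^2$ with $x\ge 8$ or $y\ge 8$. Then the Grundy number of $(x,y)$ in the variant of Wythoff's game with terminal set $T=\{(x,y):x+y\le 2\}$ equals $1$ if and only if $(x,y)$ is a $\mathcal{P}$-position of Wythoff's game, i.e. if and only if $(x,y)\in\{(\lfloor n\phi\rfloor,\lfloor n(\phi+1)\rfloor):n\ge0\}\cup\{(\lfloor n(\phi+1)\rfloor,\lfloor n\phi\rfloor):n\ge0\}$, where $\phi=\frac{1+\sqrt5}{2}$.
   Context: Moves: from $(x,y)\in\mathbb{Z}_{\geq0}^2$ one may move to any $(u,y)$ with $0\le u<x$, any $(x,v)$ with $0\le v<y$, or any $(x-t,y-t)$ with $1\le t\le\min(x,y)$. In the variant, positions in $T=\{(x,y):x+y\le2\}$ are terminal (have no moves), and the player moving into $T$ wins. The Grundy number of a position $p$ is $G(p)=\mathrm{mex}\{G(q): q \text{ reachable from } p \text{ in one move}\}$, where $\mathrm{mex}$ of a set of nonnegative integers is the least nonnegative integer not in it (so terminal positions have Grundy number $0$). A $\mathcal{P}$-position of Wythoff's game (queen moves, player moving to $(0,0)$ wins) is one from which the previous player wins with correct play. -}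

module Defs where

open import Data.Nat using (ℕ; zero; suc; _+_; _∸_; _≤ᵇ_; _≡ᵇ_)
open import Data.Nat using (_⊓_)
open import Data.Bool using (Bool; true; false; if_then_else_; not)
open import Data.List using (List; []; _∷_; map; _++_; upTo; length)
open import Data.Product using (_×_; _,_)

Pos : Set
Pos = ℕ × ℕ

queenMoves : ℕ → ℕ → List Pos
queenMoves x y =
  map (λ u → (u , y)) (upTo x) ++
  map (λ v → (x , v)) (upTo y) ++
  map (λ t → (x ∸ suc t , y ∸ suc t)) (upTo (x ⊓ y))

allᵇ : {A : Set} → (A → Bool) → List A → Bool
allᵇ p []       = true
allᵇ p (a ∷ as) = if p a then allᵇ p as else false

elemᵇ : ℕ → List ℕ → Bool
elemᵇ n []       = false
elemᵇ n (m ∷ ms) = if n ≡ᵇ m then true else elemᵇ n ms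

-- mex: least natural number not in the list.  Searching candidates
-- k, k+1, ... with fuel (length l + 1) suffices since the answer is ≤ length l.
mexFrom : ℕ → ℕ → List ℕ → ℕ
mexFrom zero    k l = k
mexFrom (suc f) k l = if elemᵇ k l then mexFrom f (suc k) l else k

mex : List ℕ → ℕ
mex l = mexFrom (suc (length l)) 0 l

variantMoves : ℕ → ℕ → List Pos
variantMoves x y = if (x + y) ≤ᵇ 2 then [] else queenMoves x y

-- Grundy number with fuel; every move strictly decreases x + y, so fuel
-- suc (x + y) is always sufficient.
grundyF : ℕ → ℕ → ℕ → ℕ
grundyF zero    x y = 0
grundyF (suc f) x y = mex (map (λ { (u , v) → grundyF f u v }) (variantMoves x y))

variantGrundy : ℕ → ℕ → ℕ
variantGrundy x y = grundyF (suc (x + y)) x y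

isPF : ℕ → ℕ → ℕ → Bool
isPF zero    x y = true
isPF (suc f) x y = allᵇ (λ { (u , v) → not (isPF f u v) }) (queenMoves x y)

isWythoffP : ℕ → ℕ → Bool
isWythoffP x y = isPF (suc (x + y)) x y

{-# OPTIONS --safe #-}
module Submission where

-- Both Grundy-zero sets involved are kernels of one kind: in the queen game whose terminal set is
-- the triangle x + y ≤ t, the P-positions are the triangle together with the pairs (a , a + rank a)
-- and their mirror images, where a > t runs over the numbers that are not the larger coordinate of
-- an earlier pair and rank a counts such numbers below a (t = 0 is Wythoff's game, t = 2 the
-- variant).  The variant's sequence is Wythoff's shifted by 2, up to transpositions of neighbours,
-- so its rank exceeds Wythoff's at every Wythoff lower coordinate a ≥ 3, and no Wythoff P-position
-- outside the 8 × 8 box has Grundy value 0 in the variant.  Outside the box the Wythoff P-positions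
-- therefore satisfy the recursion that characterises Grundy value 1: a large position reaches every
-- small position in its row, column and diagonal, and inside the box every such line through a
-- Grundy-one position also meets a Wythoff P-position, and conversely.

open import Defs
open import Data.Bool using (Bool; true; false; not; _∧_; _∨_; if_then_else_)
import Data.Bool as Bool
open import Data.Bool.Properties using (not-involutive; ¬-not; ⇔→≡; ∧-zeroʳ; T-≡)
open import Data.List using (List; []; _∷_; map; upTo; filter; cartesianProduct; length)
open import Data.List.Membership.Propositional using (_∈_; find; lose)
open import Data.List.Membership.Propositional.Properties
  using (∈-map⁺; ∈-map⁻; ∈-++⁺ˡ; ∈-++⁺ʳ; ∈-++⁻; ∈-upTo⁺; ∈-upTo⁻; ∈-filter⁺; ∈-filter⁻;
         ∈-cartesianProduct⁺; ∈-cartesianProduct⁻)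
open import Data.List.Relation.Unary.All using (All; all?)
import Data.List.Relation.Unary.All as All
open import Data.List.Relation.Unary.Any using (Any; any?; here; there)
open import Data.Nat
open import Data.Nat.Induction using (<-rec)
open import Data.Nat.Properties
open import Algebra.Properties.CommutativeSemigroup +-commutativeSemigroup using (xy∙z≈xz∙y)
open import Data.Nat.Tactic.RingSolver using (solve-∀)
open import Data.Product using (∃-syntax; _×_; _,_; proj₁; proj₂)
open import Data.Product.Properties using (≡-dec)
open import Data.List.Membership.DecPropositional (≡-dec _≟_ _≟_) using (_∈?_)
open import Data.Sum using (_⊎_; inj₁; inj₂) renaming (swap to ⊎-swap)
open import Function using (_∘_)
open import Function.Bundles using (_⇔_; mk⇔; Equivalence)
open import Relation.Binary using (tri<; tri≈; tri>)
open import Relation.Binary.PropositionalEquality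
open import Relation.Nullary using (¬_; Dec; yes; no; does; contradiction)
open import Relation.Nullary.Decidable using (_×-dec_; _⊎-dec_; dec-true; dec-false; from-yes)

data Move : Pos → Pos → Set where
  rowMove      : ∀ {x y u} → u < x → Move (x , y) (u , y)
  columnMove   : ∀ {x y v} → v < y → Move (x , y) (x , v)
  diagonalMove : ∀ {u v} d → Move (u + suc d , v + suc d) (u , v)

diagonalMove′ : ∀ {x y u v} d → x ≡ u + suc d → y ≡ v + suc d → Move (x , y) (u , v)
diagonalMove′ d refl refl = diagonalMove d

Move-swap : ∀ {x y u v} → Move (x , y) (u , v) → Move (y , x) (v , u)
Move-swap (rowMove u<x)    = columnMove u<x
Move-swap (columnMove v<y) = rowMove v<y
Move-swap (diagonalMove d) = diagonalMove d

Move-sum-< : ∀ {x y u v} → Move (x , y) (u , v) → u + v < x + y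
Move-sum-< {y = y} (rowMove u<x)    = +-monoˡ-< y u<x
Move-sum-< {x = x} (columnMove v<y) = +-monoʳ-< x v<y
Move-sum-< {u = u} {v} (diagonalMove d) = +-mono-< (m<m+n u z<s) (m<m+n v z<s)

∈queenMoves⇒Move : ∀ {x y q} → q ∈ queenMoves x y → Move (x , y) q
∈queenMoves⇒Move {x} {y} q∈ with ∈-++⁻ (map (λ u → (u , y)) (upTo x)) q∈
... | inj₁ q∈row with u , u∈ , refl ← ∈-map⁻ _ q∈row = rowMove (∈-upTo⁻ u∈)
... | inj₂ q∈rest with ∈-++⁻ (map (λ v → (x , v)) (upTo y)) q∈rest
...   | inj₁ q∈col with v , v∈ , refl ← ∈-map⁻ _ q∈col = columnMove (∈-upTo⁻ v∈)
...   | inj₂ q∈diag with d , d∈ , refl ← ∈-map⁻ _ q∈diag =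
  diagonalMove′ d (sym (m∸n+n≡m (m≤n⊓o⇒m≤n x y d<x⊓y))) (sym (m∸n+n≡m (m≤n⊓o⇒m≤o x y d<x⊓y)))
  where
  d<x⊓y : d < x ⊓ y
  d<x⊓y = ∈-upTo⁻ d∈

Move⇒∈queenMoves : ∀ {x y q} → Move (x , y) q → q ∈ queenMoves x y
Move⇒∈queenMoves (rowMove u<x) = ∈-++⁺ˡ (∈-map⁺ _ (∈-upTo⁺ u<x))
Move⇒∈queenMoves {x} (columnMove v<y) = ∈-++⁺ʳ (map _ (upTo x)) (∈-++⁺ˡ (∈-map⁺ _ (∈-upTo⁺ v<y)))
Move⇒∈queenMoves {_} {_} {u , v} (diagonalMove d) =
  ∈-++⁺ʳ (map _ (upTo x)) (∈-++⁺ʳ (map _ (upTo y))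
    (subst (_∈ map diagonalStep (upTo (x ⊓ y))) (cong₂ _,_ (m+n∸n≡m u (suc d)) (m+n∸n≡m v (suc d)))
      (∈-map⁺ diagonalStep (∈-upTo⁺ (⊓-glb (m≤n+m (suc d) u) (m≤n+m (suc d) v))))))
  where
  x y : ℕ
  x = u + suc d
  y = v + suc d
  diagonalStep : ℕ → Pos
  diagonalStep t = x ∸ suc t , y ∸ suc t

module _ {A : Set} {f : A → Bool} where

  allᵇ-true⁻ : ∀ {l a} → allᵇ f l ≡ true → a ∈ l → f a ≡ true
  allᵇ-true⁻ {b ∷ l} all≡ a∈ with f b in fb
  allᵇ-true⁻ {b ∷ l} all≡ (here refl) | true = fb
  allᵇ-true⁻ {b ∷ l} all≡ (there a∈)  | true = allᵇ-true⁻ all≡ a∈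

  allᵇ-true⁺ : ∀ {l} → (∀ {a} → a ∈ l → f a ≡ true) → allᵇ f l ≡ true
  allᵇ-true⁺ {[]}    _    = refl
  allᵇ-true⁺ {b ∷ l} all≡ rewrite all≡ (here refl) = allᵇ-true⁺ (all≡ ∘ there)

  allᵇ-false⁻ : ∀ {l} → allᵇ f l ≡ false → ∃[ a ] a ∈ l × f a ≡ false
  allᵇ-false⁻ {b ∷ l} all≡ with f b in fb
  ... | true  = let a , a∈ , fa = allᵇ-false⁻ all≡ in a , there a∈ , fa
  ... | false = b , here refl , fb

  allᵇ-false⁺ : ∀ {l a} → a ∈ l → f a ≡ false → allᵇ f l ≡ false
  allᵇ-false⁺ {l} a∈ fa with allᵇ f l in all≡
  ... | true  = contradiction (trans (sym (allᵇ-true⁻ all≡ a∈)) fa) λ ()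
  ... | false = refl

allᵇ-cong : ∀ {A : Set} {f g : A → Bool} {l} → (∀ {a} → a ∈ l → f a ≡ g a) → allᵇ f l ≡ allᵇ g l
allᵇ-cong {l = []}    _   = refl
allᵇ-cong {g = g} {a ∷ l} f≡g rewrite f≡g (here refl) with g a
... | true  = allᵇ-cong (f≡g ∘ there)
... | false = refl

module _ {f : Pos → Bool} (x y : ℕ) where

  allMoves-true⁻ : allᵇ f (queenMoves x y) ≡ true → ∀ {q} → Move (x , y) q → f q ≡ true
  allMoves-true⁻ all≡ = allᵇ-true⁻ all≡ ∘ Move⇒∈queenMoves

  allMoves-true⁺ : (∀ {q} → Move (x , y) q → f q ≡ true) → allᵇ f (queenMoves x y) ≡ true
  allMoves-true⁺ f≡ = allᵇ-true⁺ (f≡ ∘ ∈queenMoves⇒Move)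

  allMoves-false⁻ : allᵇ f (queenMoves x y) ≡ false → ∃[ q ] Move (x , y) q × f q ≡ false
  allMoves-false⁻ all≡ = let q , q∈ , fq = allᵇ-false⁻ all≡ in q , ∈queenMoves⇒Move q∈ , fq

  allMoves-false⁺ : ∀ {q} → Move (x , y) q → f q ≡ false → allᵇ f (queenMoves x y) ≡ false
  allMoves-false⁺ = allᵇ-false⁺ ∘ Move⇒∈queenMoves

  allMoves-cong : ∀ {g} → (∀ {q} → Move (x , y) q → f q ≡ g q) →
                  allᵇ f (queenMoves x y) ≡ allᵇ g (queenMoves x y)
  allMoves-cong f≡g = allᵇ-cong (f≡g ∘ ∈queenMoves⇒Move)

dec-true⁻ : ∀ {A : Set} (a? : Dec A) → does a? ≡ true → A
dec-true⁻ (yes a) _ = a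

kernel-recursion : ∀ {P : Pos → Set} (P? : ∀ p → Dec (P p)) {x y} →
                   (P (x , y) → ∀ {q} → Move (x , y) q → ¬ P q) →
                   (¬ P (x , y) → ∃[ q ] Move (x , y) q × P q) →
                   does (P? (x , y)) ≡ allᵇ (not ∘ does ∘ P?) (queenMoves x y)
kernel-recursion P? {x} {y} independent absorbing with P? (x , y)
... | yes Pp = sym (allMoves-true⁺ x y λ mv → cong not (dec-false (P? _) (independent Pp mv)))
... | no ¬Pp = let q , mv , Pq = absorbing ¬Pp in
               sym (allMoves-false⁺ x y mv (cong not (dec-true (P? q) Pq)))

bit : Bool → ℕ
bit true  = 1
bit false = 0

module WythoffPairs (t : ℕ) where

  private
    Entry : Set
    Entry = ℕ × Bool × ℕ

    RecordsPair : ℕ → Entry → Set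
    RecordsPair m (j , b , r) = t < j × b ≡ true × j + r ≡ m

    recordsPair? : ∀ m e → Dec (RecordsPair m e)
    recordsPair? m (j , b , r) = (t <? j) ×-dec (b Bool.≟ true) ×-dec (j + r ≟ m)

    nextLower : ℕ → List Entry → Bool
    nextLower m h = (m ≤ᵇ t) ∨ not (does (any? (recordsPair? m) h))

    nextRank : List Entry → ℕ
    nextRank []              = 0
    nextRank ((_ , b , r) ∷ _) = r + bit b

    -- history m lists (j , lower j , rank j) for j < m, newest first.  It is passed to record-next
    -- as an argument so that evaluation of closed instances shares it rather than recomputing it.
    record-next : ℕ → List Entry → List Entry
    record-next m h = (m , nextLower m h , nextRank h) ∷ h

    history : ℕ → List Entry
    history zero    = []
    history (suc m) = record-next m (history m)

  lower : ℕ → Bool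
  lower m = nextLower m (history m)

  rank : ℕ → ℕ
  rank m = nextRank (history m)

  lower-≤ : ∀ {m} → m ≤ t → lower m ≡ true
  lower-≤ {m} m≤t with m ≤ᵇ t | ≤⇒≤ᵇ m≤t
  ... | true | _ = refl

  rank-mono : ∀ {j k} → j ≤ k → rank j ≤ rank k
  rank-mono = mono′ ∘ ≤⇒≤′
    where
    mono′ : ∀ {j k} → j ≤′ k → rank j ≤ rank k
    mono′ ≤′-refl          = ≤-refl
    mono′ (≤′-step j≤′k) = ≤-trans (mono′ j≤′k) (m≤m+n _ _)

  rank-strict : ∀ {j k} → j < k → lower j ≡ true → rank j < rank k
  rank-strict {j} {k} j<k lj = begin-strict
    rank j              <⟨ m<m+n (rank j) z<s ⟩
    rank j + 1          ≡⟨ cong (λ b → rank j + bit b) (sym lj) ⟩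
    rank (suc j)        ≤⟨ rank-mono j<k ⟩
    rank k              ∎
    where open ≤-Reasoning

  rank-≤ : ∀ m → rank m ≤ m
  rank-≤ zero    = z≤n
  rank-≤ (suc m) = ≤-trans (+-mono-≤ (rank-≤ m) (bit≤1 (lower m))) (≤-reflexive (+-comm m 1))
    where
    bit≤1 : ∀ b → bit b ≤ 1
    bit≤1 true  = ≤-refl
    bit≤1 false = z≤n

  rank-small : ∀ {m} → m ≤ suc t → rank m ≡ m
  rank-small {zero}  _     = refl
  rank-small {suc m} m<1+t = begin
    rank m + bit (lower m) ≡⟨ cong₂ (λ r b → r + bit b) (rank-small (<⇒≤ m<1+t)) (lower-≤ (≤-pred m<1+t)) ⟩
    m + 1                  ≡⟨ +-comm m 1 ⟩
    suc m                  ∎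
    where open ≡-Reasoning

  rank->t : ∀ {m} → t < m → t < rank m
  rank->t t<m = ≤-trans (≤-reflexive (sym (rank-small ≤-refl))) (rank-mono t<m)

  rank-jump : ∀ {b d} → rank b ≤ d → d < rank (suc b) → lower b ≡ true × rank b ≡ d
  rank-jump {b} {d} rb≤d d<rb′ with lower b
  ... | true  = refl , ≤-antisym rb≤d (≤-pred (subst (d <_) (+-comm (rank b) 1) d<rb′))
  ... | false = contradiction (subst (d <_) (+-identityʳ (rank b)) d<rb′) (≤⇒≯ rb≤d)

  rank-intermediate : ∀ {a d} b → rank a ≤ d → d < rank b →
                      ∃[ j ] a ≤ j × j < b × lower j ≡ true × rank j ≡ d
  rank-intermediate zero    _    ()
  rank-intermediate {a} {d} (suc b) ra≤d d<rb′ with d <? rank b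
  ... | yes d<rb = let j , a≤j , j<b , lj , rj = rank-intermediate b ra≤d d<rb in
                   j , a≤j , m<n⇒m<1+n j<b , lj , rj
  ... | no d≮rb  = b , a≤b , n<1+n b , rank-jump {b} (≮⇒≥ d≮rb) d<rb′
    where
    a≤b : a ≤ b
    a≤b with a ≤? b
    ... | yes a≤b = a≤b
    ... | no a≰b  = contradiction (≤-trans (rank-mono (≰⇒> a≰b)) ra≤d) (<⇒≱ d<rb′)

  Pair : ℕ → ℕ → Set
  Pair x y = t < x × lower x ≡ true × y ≡ x + rank x

  pair? : ∀ x y → Dec (Pair x y)
  pair? x y = (t <? x) ×-dec (lower x Bool.≟ true) ×-dec (y ≟ x + rank x)

  Pair⇒< : ∀ {x y} → Pair x y → x < y
  Pair⇒< {x} (t<x , _ , refl) = m<m+n x (≤-trans (s≤s z≤n) (rank->t t<x))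

  Pair-lower-bound : ∀ {c x y} → Pair x y → c + c ≤ y → c ≤ x
  Pair-lower-bound {c} {x} (_ , _ , refl) c+c≤y with c ≤? x
  ... | yes c≤x = c≤x
  ... | no c≰x  = contradiction (≤-trans c+c≤y (+-monoʳ-≤ x (rank-≤ x)))
                                (<⇒≱ (+-mono-< (≰⇒> c≰x) (≰⇒> c≰x)))

  Pair-injective : ∀ {j k m} → Pair j m → Pair k m → j ≡ k
  Pair-injective {j} {k} (_ , lj , refl) (_ , lk , eq) with <-cmp j k
  ... | tri< j<k _ _ = contradiction eq (<⇒≢ (+-mono-< j<k (rank-strict j<k lj)))
  ... | tri≈ _ j≡k _ = j≡k
  ... | tri> _ _ k<j = contradiction (sym eq) (<⇒≢ (+-mono-< k<j (rank-strict k<j lk)))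

  Upper : ℕ → Set
  Upper m = ∃[ j ] Pair j m

  private
    history-entry : ∀ {k e} → e ∈ history k → ∃[ j ] j < k × e ≡ (j , lower j , rank j)
    history-entry {suc k} (here refl) = k , n<1+n k , refl
    history-entry {suc k} (there e∈)  = let j , j<k , e≡ = history-entry e∈ in j , m<n⇒m<1+n j<k , e≡

    history-complete : ∀ {j k} → j < k → (j , lower j , rank j) ∈ history k
    history-complete {j} {suc k} j<1+k with m≤n⇒m<n∨m≡n (≤-pred j<1+k)
    ... | inj₁ j<k  = there (history-complete j<k)
    ... | inj₂ refl = here refl

  lower-false⁻ : ∀ {m} → lower m ≡ false → Upper m
  lower-false⁻ {m} lm with m ≤ᵇ t | any? (recordsPair? m) (history m)
  ... | false | yes recorded with find recorded
  ...   | _ , e∈ , t<j , lj , eq with history-entry e∈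
  ...     | j , _ , refl = j , t<j , lj , sym eq

  lower-false⁺ : ∀ {m} → Upper m → lower m ≡ false
  lower-false⁺ {m} (j , pair@(t<j , lj , m≡)) with m ≤ᵇ t | ≤ᵇ⇒≤ m t | any? (recordsPair? m) (history m)
  ... | true  | m≤t | _       = contradiction (m≤t _) (<⇒≱ (<-trans t<j (Pair⇒< pair)))
  ... | false | _   | yes _   = refl
  ... | false | _   | no ¬rec = contradiction (lose (history-complete (Pair⇒< pair)) (t<j , lj , sym m≡)) ¬rec

module Triangle (t : ℕ) where
  open WythoffPairs t public

  Terminal : Pos → Set
  Terminal (x , y) = x + y ≤ t

  PPosition : Pos → Set
  PPosition (x , y) = Terminal (x , y) ⊎ Pair x y ⊎ Pair y x

  pPosition? : ∀ p → Dec (PPosition p)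
  pPosition? (x , y) = (x + y ≤? t) ⊎-dec pair? x y ⊎-dec pair? y x

  isP : Pos → Bool
  isP p = does (pPosition? p)

  ¬Terminalˡ : ∀ {x y} → t < x → ¬ Terminal (x , y)
  ¬Terminalˡ {x} t<x x+y≤t = <⇒≱ t<x (≤-trans (m≤m+n x _) x+y≤t)

  ¬Terminalʳ : ∀ {x y} → t < y → ¬ Terminal (x , y)
  ¬Terminalʳ {x} {y} t<y x+y≤t = <⇒≱ t<y (≤-trans (m≤n+m y x) x+y≤t)

  PPosition-swap : ∀ {x y} → PPosition (x , y) → PPosition (y , x)
  PPosition-swap {x} {y} (inj₁ x+y≤t)       = inj₁ (subst (_≤ t) (+-comm x y) x+y≤t)
  PPosition-swap         (inj₂ (inj₁ pair)) = inj₂ (inj₂ pair)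
  PPosition-swap         (inj₂ (inj₂ pair)) = inj₂ (inj₁ pair)

  Pair-independent : ∀ {x y q} → Pair x y → Move (x , y) q → ¬ PPosition q
  Pair-independent pair@(t<x , _ , _) (rowMove u<x) (inj₁ term) =
    ¬Terminalʳ (<-trans t<x (Pair⇒< pair)) term
  Pair-independent pair (rowMove u<x) (inj₂ (inj₁ pair′)) =
    <-irrefl (Pair-injective pair′ pair) u<x
  Pair-independent pair (rowMove u<x) (inj₂ (inj₂ pair′)) =
    <-asym (<-trans u<x (Pair⇒< pair)) (Pair⇒< pair′)
  Pair-independent (t<x , _ , _) (columnMove v<y) (inj₁ term) = ¬Terminalˡ t<x term
  Pair-independent (_ , _ , y≡) (columnMove v<y) (inj₂ (inj₁ (_ , _ , v≡))) =
    <-irrefl (trans v≡ (sym y≡)) v<y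
  Pair-independent (_ , lx , _) (columnMove v<y) (inj₂ (inj₂ pair′)) =
    contradiction (trans (sym lx) (lower-false⁺ (_ , pair′))) λ ()
  Pair-independent {x} (t<x , lx , y≡) (diagonalMove {u} {v} d) = λ where
      (inj₁ term)                 → ¬Terminalʳ (≤-trans (rank->t t<x) (≤-trans (m≤n+m _ u) (≤-reflexive (sym v≡))))
                                               term
      (inj₂ (inj₁ (_ , lu , v≡′))) → <-irrefl (+-cancelˡ-≡ u _ _ (trans (sym v≡′) v≡))
                                               (rank-strict (m<m+n u z<s) lu)
      (inj₂ (inj₂ pair′))          → <⇒≱ (Pair⇒< pair′) (≤-trans (m≤m+n u _) (≤-reflexive (sym v≡)))
    where
    v≡ : v ≡ u + rank x
    v≡ = +-cancelʳ-≡ (suc d) v (u + rank x) (trans y≡ (xy∙z≈xz∙y u (suc d) (rank x)))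

  absorbing-diagonal : ∀ {x d} → t < x → lower x ≡ true → d < rank x →
                       ∃[ q ] Move (x , x + d) q × PPosition q
  absorbing-diagonal {x} {d} t<x lx d<rx with d ≤? t
  ... | yes d≤t = (0 , d) , diagonalMove′ (x ∸ 1) x≡ (trans (cong (_+ d) x≡) (+-comm (suc (x ∸ 1)) d)) , inj₁ d≤t
    where
    x≡ : x ≡ suc (x ∸ 1)
    x≡ = sym (m+[n∸m]≡n (≤-trans (s≤s z≤n) t<x))
  ... | no d≰t with rank-intermediate x (≤-trans (≤-reflexive (rank-small ≤-refl)) (≰⇒> d≰t)) d<rx
  ...   | j , t<j , j<x , lj , rj≡d =
    (j , j + d) , diagonalMove′ k x≡ (trans (cong (_+ d) x≡) (xy∙z≈xz∙y j (suc k) d)) ,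
    inj₂ (inj₁ (t<j , lj , cong (j +_) (sym rj≡d)))
    where
    k : ℕ
    k = x ∸ suc j
    x≡ : x ≡ j + suc k
    x≡ = trans (sym (m+[n∸m]≡n j<x)) (sym (+-suc j k))

  absorbing-≤ : ∀ {x y} → x ≤ y → ¬ PPosition (x , y) → ∃[ q ] Move (x , y) q × PPosition q
  absorbing-≤ {x} {y} x≤y ¬P with x ≤? t
  ... | yes x≤t = (x , 0) , columnMove 0<y , inj₁ x+0≤t
    where
    x+0≤t : x + 0 ≤ t
    x+0≤t = subst (_≤ t) (sym (+-identityʳ x)) x≤t
    0<y : 0 < y
    0<y = n≢0⇒n>0 λ { refl → ¬P (inj₁ x+0≤t) }
  ... | no x≰t with lower x Bool.≟ true
  ...   | no ¬lx = let j , pair = lower-false⁻ (¬-not ¬lx) in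
                  (x , j) , columnMove (<-≤-trans (Pair⇒< pair) x≤y) , inj₂ (inj₂ pair)
  ...   | yes lx with <-cmp y (x + rank x)
  ...     | tri> _ _ y> = (x , x + rank x) , columnMove y> , inj₂ (inj₁ (≰⇒> x≰t , lx , refl))
  ...     | tri≈ _ y≡ _ = contradiction (inj₂ (inj₁ (≰⇒> x≰t , lx , y≡))) ¬P
  ...     | tri< y< _ _ = subst (λ y → ∃[ q ] Move (x , y) q × PPosition q) (m+[n∸m]≡n x≤y)
                            (absorbing-diagonal (≰⇒> x≰t) lx
                              (+-cancelˡ-< x _ _ (subst (_< x + rank x) (sym (m+[n∸m]≡n x≤y)) y<)))

  absorbing : ∀ {p} → ¬ PPosition p → ∃[ q ] Move p q × PPosition q
  absorbing {x , y} ¬P with x ≤? y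
  ... | yes x≤y = absorbing-≤ x≤y ¬P
  ... | no x≰y  = let (v , u) , y,x→v,u , Pv,u = absorbing-≤ (<⇒≤ (≰⇒> x≰y)) (¬P ∘ PPosition-swap) in
                  (u , v) , Move-swap y,x→v,u , PPosition-swap Pv,u

  isP-kernel : ∀ x y → ¬ Terminal (x , y) → isP (x , y) ≡ allᵇ (not ∘ isP) (queenMoves x y)
  isP-kernel x y ¬term = kernel-recursion pPosition? independent absorbing
    where
    independent : PPosition (x , y) → ∀ {q} → Move (x , y) q → ¬ PPosition q
    independent (inj₁ term)        _  = contradiction term ¬term
    independent (inj₂ (inj₁ pair)) mv = Pair-independent pair mv
    independent (inj₂ (inj₂ pair)) mv = Pair-independent pair (Move-swap mv) ∘ PPosition-swap

module Wythoff = Triangle 0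
module Variant = Triangle 2

wythoffP : Pos → Bool
wythoffP = Wythoff.isP

variantP : Pos → Bool
variantP = Variant.isP

wythoffP-kernel : ∀ x y → wythoffP (x , y) ≡ allᵇ (not ∘ wythoffP) (queenMoves x y)
wythoffP-kernel zero    zero    = refl
wythoffP-kernel zero    (suc y) = Wythoff.isP-kernel 0 (suc y) λ ()
wythoffP-kernel (suc x) y       = Wythoff.isP-kernel (suc x) y λ ()

isPF≡wythoffP : ∀ f x y → x + y < f → isPF f x y ≡ wythoffP (x , y)
isPF≡wythoffP (suc f) x y x+y<1+f = trans
  (allMoves-cong x y λ {(u , v)} mv → cong not (isPF≡wythoffP f u v (<-≤-trans (Move-sum-< mv) (≤-pred x+y<1+f))))
  (sym (wythoffP-kernel x y))

wythoffP-independent : ∀ {x y q} → wythoffP (x , y) ≡ true → Move (x , y) q → wythoffP q ≡ false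
wythoffP-independent {x} {y} w mv =
  trans (sym (not-involutive _)) (cong not (allMoves-true⁻ x y (trans (sym (wythoffP-kernel x y)) w) mv))

wythoffP-absorbing : ∀ {x y} → wythoffP (x , y) ≡ false → ∃[ q ] Move (x , y) q × wythoffP q ≡ true
wythoffP-absorbing {x} {y} w with allMoves-false⁻ x y (trans (sym (wythoffP-kernel x y)) w)
... | q , mv , ¬wq = q , mv , trans (sym (not-involutive _)) (cong not ¬wq)

module Coupling where
  module W = Wythoff
  module V = Variant

  -- From 7 on, V.lower m is W.lower (2 + m), except that the bits at switch k and switch k + 1
  -- are transposed; the transposition at switch k moves on to switch (k + 1), the upper
  -- coordinate of the variant's pair at switch k.
  switch : ℕ → ℕ
  switch zero    = 10
  switch (suc k) = switch k + V.rank (switch k)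

  10≤switch : ∀ k → 10 ≤ switch k
  10≤switch zero    = ≤-refl
  10≤switch (suc k) = ≤-trans (10≤switch k) (m≤m+n _ _)

  switch-gap : ∀ k → 3 + switch k ≤ switch (suc k)
  switch-gap k = subst (_≤ switch (suc k)) (+-comm (switch k) 3)
                   (+-monoʳ-≤ (switch k) (V.rank->t (≤-trans (≤ᵇ⇒≤ 3 10 _) (10≤switch k))))

  switch-increasing : ∀ {j k} → j < k → 3 + switch j ≤ switch k
  switch-increasing {j} (s≤s j≤k) = go (≤⇒≤′ j≤k)
    where
    go : ∀ {k} → j ≤′ k → 3 + switch j ≤ switch (suc k)
    go ≤′-refl       = switch-gap j
    go (≤′-step {k} j≤k) = ≤-trans (go j≤k) (≤-trans (m≤n+m _ 3) (switch-gap (suc k)))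

  switch-mono : ∀ {j k} → j ≤ k → switch j ≤ switch k
  switch-mono j≤k with m≤n⇒m<n∨m≡n j≤k
  ... | inj₁ j<k  = ≤-trans (m≤n+m _ 3) (switch-increasing j<k)
  ... | inj₂ refl = ≤-refl

  switch<switch-suc : ∀ k → switch k < switch (suc k)
  switch<switch-suc k = ≤-trans (m≤n+m _ 2) (switch-gap k)

  2<switch : ∀ k → 2 < switch k
  2<switch k = ≤-trans (≤ᵇ⇒≤ 3 10 _) (10≤switch k)

  16≤switch-suc : ∀ k → 16 ≤ switch (suc k)
  16≤switch-suc k = ≤-trans (≤ᵇ⇒≤ 16 18 _) (switch-mono {1} {suc k} (s≤s z≤n))

  switch-injective : ∀ j k → switch j ≡ switch k → j ≡ k
  switch-injective j k eq with <-cmp j k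
  ... | tri< j<k _ _ = contradiction eq (<⇒≢ (≤-trans (m≤n+m _ 2) (switch-increasing j<k)))
  ... | tri≈ _ j≡k _ = j≡k
  ... | tri> _ _ k<j = contradiction (sym eq) (<⇒≢ (≤-trans (m≤n+m _ 2) (switch-increasing k<j)))

  switch≢suc-switch : ∀ j k → switch j ≢ suc (switch k)
  switch≢suc-switch j k eq with <-cmp j k
  ... | tri< j<k _ _ = <⇒≢ (≤-trans (s≤s (m≤n+m _ 3)) (s≤s (switch-increasing j<k))) eq
  ... | tri≈ _ refl _ = 1+n≢n (sym eq)
  ... | tri> _ _ k<j = <⇒≢ (≤-trans (s≤s (s≤s (m≤n+m _ 1))) (switch-increasing k<j)) (sym eq)

  switch-segment : ∀ {m} → 10 ≤′ m → ∃[ k ] switch k ≤ m × m < switch (suc k)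
  switch-segment ≤′-refl = 0 , ≤-refl , ≤ᵇ⇒≤ 11 18 _
  switch-segment (≤′-step 10≤m) with switch-segment 10≤m
  ... | k , sk≤m , m<sk′ with m≤n⇒m<n∨m≡n m<sk′
  ...   | inj₁ 1+m<sk′ = k , m≤n⇒m≤1+n sk≤m , 1+m<sk′
  ...   | inj₂ 1+m≡sk′ = suc k , ≤-reflexive (sym 1+m≡sk′) ,
                         subst (_< switch (suc (suc k))) (sym 1+m≡sk′) (≤-trans (m≤n+m _ 2) (switch-gap (suc k)))

  Regular : ℕ → Set
  Regular m = (∀ k → switch k ≢ m) × (∀ k → suc (switch k) ≢ m)

  data Kind (m : ℕ) : Set where
    regular     : Regular m → Kind m
    atSwitch    : ∀ k → switch k ≡ m → Kind m
    afterSwitch : ∀ k → suc (switch k) ≡ m → Kind m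

  kind : ∀ m → Kind m
  kind m with m <? 10
  ... | yes m<10 = regular ((λ k eq → <⇒≱ m<10 (subst (10 ≤_) eq (10≤switch k)))
                          , (λ k eq → <⇒≱ m<10 (subst (10 ≤_) eq (m≤n⇒m≤1+n (10≤switch k)))))
  ... | no m≮10 with switch-segment (≤⇒≤′ (≮⇒≥ m≮10))
  ...   | k , sk≤m , m<sk′ with m≤n⇒m<n∨m≡n sk≤m
  ...     | inj₂ sk≡m = atSwitch k sk≡m
  ...     | inj₁ sk<m with m≤n⇒m<n∨m≡n sk<m
  ...       | inj₂ 1+sk≡m = afterSwitch k 1+sk≡m
  ...       | inj₁ 1+sk<m = regular (not-at , not-after)
    where
    not-at : ∀ j → switch j ≢ m
    not-at j eq with j ≤? k
    ... | yes j≤k = <⇒≢ (≤-<-trans (switch-mono j≤k) sk<m) eq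
    ... | no j≰k  = <⇒≢ (<-≤-trans m<sk′ (switch-mono (≰⇒> j≰k))) (sym eq)
    not-after : ∀ j → suc (switch j) ≢ m
    not-after j eq with j ≤? k
    ... | yes j≤k = <⇒≢ (≤-<-trans (s≤s (switch-mono j≤k)) 1+sk<m) eq
    ... | no j≰k  = <⇒≢ (<-≤-trans m<sk′ (m≤n⇒m≤1+n (switch-mono (≰⇒> j≰k)))) (sym eq)

  RegularCoupled : ℕ → Set
  RegularCoupled m = V.lower m ≡ W.lower (2 + m) × V.rank m ≡ W.rank (2 + m)

  SwitchCoupled : ℕ → Set
  SwitchCoupled k = V.lower (switch k) ≡ not (W.lower (2 + switch k)) × V.rank (switch k) ≡ W.rank (2 + switch k)

  AfterSwitchCoupled : ℕ → Set
  AfterSwitchCoupled k = V.lower (suc (switch k)) ≡ W.lower (2 + switch k) × W.lower (3 + switch k) ≡ V.lower (switch k)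

  CoupledAt : ℕ → Set
  CoupledAt m = (7 ≤ m → Regular m → RegularCoupled m)
              × (∀ k → switch k ≡ m → SwitchCoupled k)
              × (∀ k → suc (switch k) ≡ m → AfterSwitchCoupled k)

  CoupledBelow : ℕ → Set
  CoupledBelow m = ∀ {j} → j < m → CoupledAt j

  module _ {m} (below : CoupledBelow m) where

    regular-below : ∀ {j} → 7 ≤ j → j < m → Regular j → RegularCoupled j
    regular-below 7≤j j<m = proj₁ (below j<m) 7≤j

    switch-below : ∀ {k} → switch k < m → SwitchCoupled k
    switch-below {k} lt = proj₁ (proj₂ (below lt)) k refl

    after-below : ∀ {k} → suc (switch k) < m → AfterSwitchCoupled k
    after-below {k} lt = proj₂ (proj₂ (below lt)) k refl

  V-transposed : ∀ {k} → SwitchCoupled k → AfterSwitchCoupled k →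
                 V.lower (switch k) ≡ not (V.lower (suc (switch k)))
  V-transposed (v≡ , _) (v′≡ , _) = trans v≡ (cong not (sym v′≡))

  W-transposed : ∀ {k} → SwitchCoupled k → AfterSwitchCoupled k →
                 W.lower (2 + switch k) ≡ not (W.lower (3 + switch k))
  W-transposed (v≡ , _) (_ , w′≡) = trans (sym (not-involutive _)) (cong not (sym (trans w′≡ v≡)))

  CommonSource : ℕ → Set
  CommonSource m = ∃[ j ] Regular j × V.Pair j m × W.Pair (2 + j) (2 + m)

  VSource : ℕ → Set
  VSource m = CommonSource m
            ⊎ (∃[ k ] V.lower (switch k) ≡ true × switch (suc k) ≡ m)
            ⊎ (∃[ k ] V.lower (suc (switch k)) ≡ true × suc (switch (suc k)) ≡ m)

  WSource : ℕ → Set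
  WSource m = CommonSource m
            ⊎ (∃[ k ] W.lower (2 + switch k) ≡ true × switch (suc k) ≡ m)
            ⊎ (∃[ k ] W.lower (3 + switch k) ≡ true × suc (switch (suc k)) ≡ m)

  V-source : ∀ {m} → 16 ≤ m → CoupledBelow m → V.lower m ≡ false → VSource m
  V-source {m} 16≤m below vm with V.lower-false⁻ vm
  ... | j , pair@(_ , vj , m≡) with kind j
  ...   | regular reg =
    let vj≡ , rj≡ = regular-below below (V.Pair-lower-bound pair (≤-trans (≤ᵇ⇒≤ 14 16 _) 16≤m))
                                        (V.Pair⇒< pair) reg
    in
    inj₁ (j , reg , pair , (z<s , trans (sym vj≡) vj , cong (2 +_) (trans m≡ (cong (j +_) rj≡))))
  ...   | atSwitch k refl = inj₂ (inj₁ (k , vj , sym m≡))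
  ...   | afterSwitch k refl = inj₂ (inj₂ (k , vj , sym (trans m≡ (cong (suc (switch k) +_) rank≡))))
    where
    vk≡false : V.lower (switch k) ≡ false
    vk≡false = trans (V-transposed {k} (switch-below below {k} (<-trans (n<1+n _) (V.Pair⇒< pair)))
                                       (after-below below {k} (V.Pair⇒< pair)))
                     (cong not vj)
    rank≡ : V.rank (suc (switch k)) ≡ V.rank (switch k)
    rank≡ = trans (cong (λ b → V.rank (switch k) + bit b) vk≡false) (+-identityʳ _)

  W-source : ∀ {m} → 16 ≤ m → CoupledBelow m → W.lower (2 + m) ≡ false → WSource m
  W-source {m} 16≤m below wm with W.lower-false⁻ wm
  ... | j′ , pair′ = shifted j′ (W.Pair-lower-bound pair′ (s≤s (s≤s 16≤m))) pair′
    where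
    shifted : ∀ j′ → 9 ≤ j′ → W.Pair j′ (2 + m) → WSource m
    shifted (suc (suc j)) (s≤s (s≤s 7≤j)) pair′@(_ , wj , 2+m≡) with kind j
    ... | regular reg =
      let vj≡ , rj≡ = regular-below below 7≤j j<m reg in
      inj₁ (j , reg , (≤-trans (≤ᵇ⇒≤ 3 7 _) 7≤j , trans vj≡ wj , trans m≡ (cong (j +_) (sym rj≡))) , pair′)
      where
      j<m : j < m
      j<m = ≤-pred (≤-pred (W.Pair⇒< pair′))
      m≡ : m ≡ j + W.rank (2 + j)
      m≡ = suc-injective (suc-injective 2+m≡)
    ... | atSwitch k refl =
      inj₂ (inj₁ (k , wj , sym (trans m≡ (cong (switch k +_) (sym (proj₂ (switch-below below {k} s<m)))))))
      where
      s<m : switch k < m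
      s<m = ≤-pred (≤-pred (W.Pair⇒< pair′))
      m≡ : m ≡ switch k + W.rank (2 + switch k)
      m≡ = suc-injective (suc-injective 2+m≡)
    ... | afterSwitch k refl = inj₂ (inj₂ (k , wj , sym (trans m≡ (cong (suc (switch k) +_) rank≡))))
      where
      1+s<m : suc (switch k) < m
      1+s<m = ≤-pred (≤-pred (W.Pair⇒< pair′))
      m≡ : m ≡ suc (switch k) + W.rank (3 + switch k)
      m≡ = suc-injective (suc-injective 2+m≡)
      sc : SwitchCoupled k
      sc = switch-below below {k} (<-trans (n<1+n _) 1+s<m)
      w2≡false : W.lower (2 + switch k) ≡ false
      w2≡false = trans (W-transposed {k} sc (after-below below {k} 1+s<m)) (cong not wj)
      rank≡ : W.rank (3 + switch k) ≡ V.rank (switch k)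
      rank≡ = trans (cong (λ b → W.rank (2 + switch k) + bit b) w2≡false) (trans (+-identityʳ _) (sym (proj₂ sc)))

  rank-coupled : ∀ {m} → 8 ≤ m → CoupledBelow m → (∀ k → suc (switch k) ≢ m) →
                 V.rank m ≡ W.rank (2 + m)
  rank-coupled {suc m} (s≤s 7≤m) below not-after with kind m
  ... | regular reg =
    let v≡ , r≡ = regular-below below 7≤m ≤-refl reg in cong₂ (λ r b → r + bit b) r≡ v≡
  ... | atSwitch k refl = contradiction refl (not-after k)
  ... | afterSwitch k refl = begin
    V.rank (switch k) + bit (V.lower (switch k)) + bit (V.lower (suc (switch k)))
      ≡⟨ cong₂ (λ r b → r + bit (V.lower (switch k)) + bit b) r≡ v′≡ ⟩
    W.rank (2 + switch k) + bit (V.lower (switch k)) + bit (W.lower (2 + switch k))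
      ≡⟨ xy∙z≈xz∙y (W.rank (2 + switch k)) _ _ ⟩
    W.rank (2 + switch k) + bit (W.lower (2 + switch k)) + bit (V.lower (switch k))
      ≡⟨ cong (λ b → W.rank (2 + switch k) + bit (W.lower (2 + switch k)) + bit b) (sym w′≡) ⟩
    W.rank (2 + switch k) + bit (W.lower (2 + switch k)) + bit (W.lower (3 + switch k)) ∎
    where
    open ≡-Reasoning
    r≡ : V.rank (switch k) ≡ W.rank (2 + switch k)
    r≡ = proj₂ (switch-below below {k} (m<n⇒m<1+n (n<1+n _)))
    v′≡ : V.lower (suc (switch k)) ≡ W.lower (2 + switch k)
    v′≡ = proj₁ (after-below below {k} (n<1+n _))
    w′≡ : W.lower (3 + switch k) ≡ V.lower (switch k)
    w′≡ = proj₂ (after-below below {k} (n<1+n _))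

  regular-step : ∀ {m} → 16 ≤ m → CoupledBelow m → Regular m → RegularCoupled m
  regular-step {m} 16≤m below (not-at , not-after) =
    ⇔→≡ {z = false} (mk⇔ V-false⇒W-false W-false⇒V-false) ,
    rank-coupled (≤-trans (≤ᵇ⇒≤ 8 16 _) 16≤m) below not-after
    where
    V-false⇒W-false : V.lower m ≡ false → W.lower (2 + m) ≡ false
    V-false⇒W-false vm with V-source 16≤m below vm
    ... | inj₁ (j , _ , _ , wpair)  = W.lower-false⁺ (2 + j , wpair)
    ... | inj₂ (inj₁ (k , _ , eq)) = contradiction eq (not-at (suc k))
    ... | inj₂ (inj₂ (k , _ , eq)) = contradiction eq (not-after (suc k))
    W-false⇒V-false : W.lower (2 + m) ≡ false → V.lower m ≡ false
    W-false⇒V-false wm with W-source 16≤m below wm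
    ... | inj₁ (j , _ , vpair , _)  = V.lower-false⁺ (j , vpair)
    ... | inj₂ (inj₁ (k , _ , eq)) = contradiction eq (not-at (suc k))
    ... | inj₂ (inj₂ (k , _ , eq)) = contradiction eq (not-after (suc k))

  switch-alternates : ∀ k → CoupledBelow (switch (suc k)) →
                      V.lower (switch (suc k)) ≡ not (V.lower (switch k))
                      × W.lower (2 + switch (suc k)) ≡ V.lower (switch k)
  switch-alternates k below with V.lower (switch k) in vk
  ... | true = V.lower-false⁺ (switch k , 2<switch k , vk , refl) , ¬-not W-not-false
    where
    sc : SwitchCoupled k
    sc = switch-below below {k} (switch<switch-suc k)
    W-not-false : W.lower (2 + switch (suc k)) ≢ false
    W-not-false w with W-source (16≤switch-suc k) below w
    ... | inj₁ (j , (not-at , _) , vpair , _) = not-at k (sym (V.Pair-injective vpair (2<switch k , vk , refl)))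
    ... | inj₂ (inj₁ (k′ , wk′ , eq)) with refl ← suc-injective (switch-injective (suc k′) (suc k) eq) =
      contradiction (trans (sym vk) (trans (proj₁ sc) (cong not wk′))) λ ()
    ... | inj₂ (inj₂ (k′ , _ , eq)) = switch≢suc-switch (suc k) (suc k′) (sym eq)
  ... | false = ¬-not V-not-false , W.lower-false⁺ (2 + switch k , W-pair)
    where
    sc : SwitchCoupled k
    sc = switch-below below {k} (switch<switch-suc k)
    wk : W.lower (2 + switch k) ≡ true
    wk = trans (sym (not-involutive _)) (cong not (trans (sym (proj₁ sc)) vk))
    W-pair : W.Pair (2 + switch k) (2 + switch (suc k))
    W-pair = z<s , wk , cong (λ r → 2 + (switch k + r)) (proj₂ sc)
    V-not-false : V.lower (switch (suc k)) ≢ false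
    V-not-false v with V-source (16≤switch-suc k) below v
    ... | inj₁ (j , (not-at , _) , _ , wpair) =
      not-at k (sym (suc-injective (suc-injective (W.Pair-injective wpair W-pair))))
    ... | inj₂ (inj₁ (k′ , vk′ , eq)) with refl ← suc-injective (switch-injective (suc k′) (suc k) eq) =
      contradiction (trans (sym vk′) vk) λ ()
    ... | inj₂ (inj₂ (k′ , _ , eq)) = switch≢suc-switch (suc k) (suc k′) (sym eq)

  after-switch-alternates : ∀ k → CoupledBelow (suc (switch (suc k))) →
                            V.lower (suc (switch (suc k))) ≡ V.lower (switch k)
                            × W.lower (3 + switch (suc k)) ≡ not (V.lower (switch k))
  after-switch-alternates k below with V.lower (switch k) in vk
  ... | true = ¬-not V-not-false , W.lower-false⁺ (3 + switch k , W-pair)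
    where
    sc : SwitchCoupled k
    sc = switch-below below {k} (m<n⇒m<1+n (switch<switch-suc k))
    ac : AfterSwitchCoupled k
    ac = after-below below {k} (s≤s (switch<switch-suc k))
    w3 : W.lower (3 + switch k) ≡ true
    w3 = trans (proj₂ ac) vk
    w2 : W.lower (2 + switch k) ≡ false
    w2 = trans (W-transposed {k} sc ac) (cong not w3)
    rank≡ : W.rank (3 + switch k) ≡ V.rank (switch k)
    rank≡ = trans (cong (λ b → W.rank (2 + switch k) + bit b) w2) (trans (+-identityʳ _) (sym (proj₂ sc)))
    W-pair : W.Pair (3 + switch k) (3 + switch (suc k))
    W-pair = z<s , w3 , cong (λ r → 3 + (switch k + r)) (sym rank≡)
    V-not-false : V.lower (suc (switch (suc k))) ≢ false
    V-not-false v with V-source (≤-trans (16≤switch-suc k) (n≤1+n _)) below v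
    ... | inj₁ (j , (_ , not-after) , _ , wpair) =
      not-after k (sym (suc-injective (suc-injective (W.Pair-injective wpair W-pair))))
    ... | inj₂ (inj₁ (k′ , _ , eq)) = switch≢suc-switch (suc k′) (suc k) eq
    ... | inj₂ (inj₂ (k′ , vk′ , eq))
        with refl ← suc-injective (switch-injective (suc k′) (suc k) (suc-injective eq)) =
      contradiction (trans (sym vk′) (trans (proj₁ ac) w2)) λ ()
  ... | false = V.lower-false⁺ (suc (switch k) , V-pair) , ¬-not W-not-false
    where
    sc : SwitchCoupled k
    sc = switch-below below {k} (m<n⇒m<1+n (switch<switch-suc k))
    ac : AfterSwitchCoupled k
    ac = after-below below {k} (s≤s (switch<switch-suc k))
    v1 : V.lower (suc (switch k)) ≡ true
    v1 = trans (sym (not-involutive _)) (cong not (trans (sym (V-transposed {k} sc ac)) vk))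
    rank≡ : V.rank (suc (switch k)) ≡ V.rank (switch k)
    rank≡ = trans (cong (λ b → V.rank (switch k) + bit b) vk) (+-identityʳ _)
    V-pair : V.Pair (suc (switch k)) (suc (switch (suc k)))
    V-pair = m<n⇒m<1+n (2<switch k) , v1 , cong (λ r → suc (switch k + r)) (sym rank≡)
    W-not-false : W.lower (3 + switch (suc k)) ≢ false
    W-not-false w with W-source (≤-trans (16≤switch-suc k) (n≤1+n _)) below w
    ... | inj₁ (j , (_ , not-after) , vpair , _) = not-after k (sym (V.Pair-injective vpair V-pair))
    ... | inj₂ (inj₁ (k′ , _ , eq)) = switch≢suc-switch (suc k′) (suc k) eq
    ... | inj₂ (inj₂ (k′ , wk′ , eq))
        with refl ← suc-injective (switch-injective (suc k′) (suc k) (suc-injective eq)) =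
      contradiction (trans (sym wk′) (trans (proj₂ ac) vk)) λ ()

  switch-step : ∀ k → CoupledBelow (switch (suc k)) → SwitchCoupled (suc k)
  switch-step k below =
    let v≡ , w≡ = switch-alternates k below in
    trans v≡ (cong not (sym w≡)) ,
    rank-coupled (≤-trans (≤ᵇ⇒≤ 8 16 _) (16≤switch-suc k)) below
                 (λ k′ eq → switch≢suc-switch (suc k) k′ (sym eq))

  after-switch-step : ∀ k → CoupledBelow (suc (switch (suc k))) → AfterSwitchCoupled (suc k)
  after-switch-step k below =
    let v≡ , w≡ = switch-alternates k (λ lt → below (m<n⇒m<1+n lt))
        v′≡ , w′≡ = after-switch-alternates k below
    in trans v′≡ (sym w≡) , trans w′≡ (sym v≡)

  regular-initial : ∀ i → 7 + i < 16 → Regular (7 + i) → RegularCoupled (7 + i)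
  regular-initial 0 _ _                  = refl , refl
  regular-initial 1 _ _                  = refl , refl
  regular-initial 2 _ _                  = refl , refl
  regular-initial 3 _ (not-at , _)       = contradiction refl (not-at 0)
  regular-initial 4 _ (_ , not-after)    = contradiction refl (not-after 0)
  regular-initial 5 _ _                  = refl , refl
  regular-initial 6 _ _                  = refl , refl
  regular-initial 7 _ _                  = refl , refl
  regular-initial 8 _ _                  = refl , refl
  regular-initial (suc (suc (suc (suc (suc (suc (suc (suc (suc i))))))))) 16+i<16 _ =
    contradiction (m≤m+n 16 i) (<⇒≱ 16+i<16)

  coupled-step : ∀ m → CoupledBelow m → CoupledAt m
  coupled-step m below with m <? 16
  ... | yes m<16 = regular-part , switch-part , after-part
    where
    regular-part : 7 ≤ m → Regular m → RegularCoupled m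
    regular-part 7≤m = subst (λ n → Regular n → RegularCoupled n) (m+[n∸m]≡n 7≤m)
                         (regular-initial (m ∸ 7) (subst (_< 16) (sym (m+[n∸m]≡n 7≤m)) m<16))
    switch-part : ∀ k → switch k ≡ m → SwitchCoupled k
    switch-part zero    _  = refl , refl
    switch-part (suc k) eq = contradiction (subst (16 ≤_) eq (16≤switch-suc k)) (<⇒≱ m<16)
    after-part : ∀ k → suc (switch k) ≡ m → AfterSwitchCoupled k
    after-part zero    _  = refl , refl
    after-part (suc k) eq = contradiction (subst (16 ≤_) eq (m≤n⇒m≤1+n (16≤switch-suc k))) (<⇒≱ m<16)
  ... | no m≮16 = (λ _ → regular-step (≮⇒≥ m≮16) below) , switch-part , after-part
    where
    switch-part : ∀ k → switch k ≡ m → SwitchCoupled k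
    switch-part zero    eq = contradiction (subst (_< 16) eq (≤ᵇ⇒≤ 11 16 _)) m≮16
    switch-part (suc k) eq = switch-step k (subst CoupledBelow (sym eq) below)
    after-part : ∀ k → suc (switch k) ≡ m → AfterSwitchCoupled k
    after-part zero    eq = contradiction (subst (_< 16) eq (≤ᵇ⇒≤ 12 16 _)) m≮16
    after-part (suc k) eq = after-switch-step k (subst CoupledBelow (sym eq) below)

  coupled : ∀ m → CoupledAt m
  coupled = <-rec CoupledAt coupled-step

  W-rank-suc≤V-rank : ∀ {m} → 3 ≤ m → W.rank (suc m) ≤ V.rank m
  W-rank-suc≤V-rank {m} 3≤m with m <? 7
  ... | yes m<7 = subst (λ n → W.rank (suc n) ≤ V.rank n) (m+[n∸m]≡n 3≤m)
                    (initial (m ∸ 3) (subst (_< 7) (sym (m+[n∸m]≡n 3≤m)) m<7))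
    where
    initial : ∀ i → 3 + i < 7 → W.rank (4 + i) ≤ V.rank (3 + i)
    initial 0 _ = ≤ᵇ⇒≤ 3 3 _
    initial 1 _ = ≤ᵇ⇒≤ 4 4 _
    initial 2 _ = ≤ᵇ⇒≤ 4 5 _
    initial 3 _ = ≤ᵇ⇒≤ 5 6 _
    initial (suc (suc (suc (suc i)))) 7+i<7 = contradiction (m≤m+n 7 i) (<⇒≱ 7+i<7)
  ... | no m≮7 with kind m
  ...   | regular reg =
    ≤-trans (W.rank-mono (n≤1+n (suc m))) (≤-reflexive (sym (proj₂ (proj₁ (coupled m) (≮⇒≥ m≮7) reg))))
  ...   | atSwitch k refl =
    ≤-trans (W.rank-mono (n≤1+n (suc (switch k)))) (≤-reflexive (sym (proj₂ (proj₁ (proj₂ (coupled _)) k refl))))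
  ...   | afterSwitch k refl =
    ≤-trans (≤-reflexive (sym (proj₂ (proj₁ (proj₂ (coupled _)) k refl)))) (m≤m+n _ _)

Large : Pos → Set
Large (x , y) = 8 ≤ x ⊎ 8 ≤ y

Wythoff-Pair⇒¬Variant : ∀ {x y} → 3 ≤ x → Wythoff.Pair x y → ¬ Variant.PPosition (x , y)
Wythoff-Pair⇒¬Variant 3≤x _ (inj₁ term) = Variant.¬Terminalˡ 3≤x term
Wythoff-Pair⇒¬Variant {x} 3≤x (_ , lx , y≡) (inj₂ (inj₁ (_ , _ , y≡′))) =
  <⇒≢ (<-≤-trans (Wythoff.rank-strict (n<1+n x) lx) (Coupling.W-rank-suc≤V-rank 3≤x))
      (+-cancelˡ-≡ x _ _ (trans (sym y≡) y≡′))
Wythoff-Pair⇒¬Variant _ pair (inj₂ (inj₂ pair′)) = <-asym (Wythoff.Pair⇒< pair) (Variant.Pair⇒< pair′)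

large-wythoffP⇒¬variantP : ∀ {x y} → Large (x , y) → wythoffP (x , y) ≡ true → variantP (x , y) ≡ false
large-wythoffP⇒¬variantP {x} {y} large w =
  dec-false (Variant.pPosition? (x , y)) (¬Variant large (dec-true⁻ (Wythoff.pPosition? (x , y)) w))
  where
  3≤lower : ∀ {a b} → Large (a , b) → Wythoff.Pair a b → 3 ≤ a
  3≤lower (inj₁ 8≤a) _    = ≤-trans (≤ᵇ⇒≤ 3 8 _) 8≤a
  3≤lower (inj₂ 8≤b) pair = Wythoff.Pair-lower-bound pair (≤-trans (≤ᵇ⇒≤ 6 8 _) 8≤b)
  ¬Variant : ∀ {a b} → Large (a , b) → Wythoff.PPosition (a , b) → ¬ Variant.PPosition (a , b)
  ¬Variant (inj₁ 8≤a) (inj₁ term) _ = Wythoff.¬Terminalˡ (≤-trans (s≤s z≤n) 8≤a) term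
  ¬Variant (inj₂ 8≤b) (inj₁ term) _ = Wythoff.¬Terminalʳ (≤-trans (s≤s z≤n) 8≤b) term
  ¬Variant large′ (inj₂ (inj₁ pair)) = Wythoff-Pair⇒¬Variant (3≤lower large′ pair) pair
  ¬Variant large′ (inj₂ (inj₂ pair)) =
    Wythoff-Pair⇒¬Variant (3≤lower (⊎-swap large′) pair) pair ∘ Variant.PPosition-swap

data Direction : Set where
  row column diagonal : Direction

Aligned : Direction → Pos → Pos → Set
Aligned row      (_ , y) (_ , v) = y ≡ v
Aligned column   (x , _) (u , _) = x ≡ u
Aligned diagonal (x , y) (u , v) = x + v ≡ u + y

aligned? : ∀ d p q → Dec (Aligned d p q)
aligned? row      (_ , y) (_ , v) = y ≟ v
aligned? column   (x , _) (u , _) = x ≟ u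
aligned? diagonal (x , y) (u , v) = x + v ≟ u + y

Aligned-trans : ∀ d {p q r} → Aligned d p q → Aligned d q r → Aligned d p r
Aligned-trans row      = trans
Aligned-trans column   = trans
Aligned-trans diagonal {x , y} {u , v} {u′ , v′} x+v≡u+y u+v′≡u′+v = +-cancelʳ-≡ (u + v) _ _ (begin
  x + v′ + (u + v)   ≡⟨ regroup x v′ u v ⟩
  x + v + (u + v′)   ≡⟨ cong₂ _+_ x+v≡u+y u+v′≡u′+v ⟩
  u + y + (u′ + v)   ≡⟨ regroup′ u y u′ v ⟩
  u′ + y + (u + v)   ∎)
  where
  open ≡-Reasoning
  regroup : ∀ a b c d → a + b + (c + d) ≡ a + d + (c + b)
  regroup = solve-∀
  regroup′ : ∀ a b c d → a + b + (c + d) ≡ c + b + (a + d)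
  regroup′ = solve-∀

Move⇒Aligned : ∀ {p q} → Move p q → ∃[ d ] Aligned d p q
Move⇒Aligned (rowMove _)              = row , refl
Move⇒Aligned (columnMove _)           = column , refl
Move⇒Aligned (diagonalMove {u} {v} d) = diagonal , trans (+-assoc u (suc d) v) (cong (u +_) (+-comm (suc d) v))

Small : Pos → Set
Small (x , y) = x < 8 × y < 8

small? : ∀ p → Dec (Small p)
small? (x , y) = (x <? 8) ×-dec (y <? 8)

¬Small⇒Large : ∀ {p} → ¬ Small p → Large p
¬Small⇒Large {x , y} ¬small with x <? 8 | y <? 8
... | yes x<8 | yes y<8 = contradiction (x<8 , y<8) ¬small
... | no x≮8  | _       = inj₁ (≮⇒≥ x≮8)
... | yes _   | no y≮8  = inj₂ (≮⇒≥ y≮8)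

Large⇒¬Small : ∀ {p} → Large p → ¬ Small p
Large⇒¬Small (inj₁ 8≤x) (x<8 , _) = <⇒≱ x<8 8≤x
Large⇒¬Small (inj₂ 8≤y) (_ , y<8) = <⇒≱ y<8 8≤y

diagonalMove-from-left : ∀ {x y u v} → u < x → x + v ≡ u + y → Move (x , y) (u , v)
diagonalMove-from-left {x} {y} {u} {v} u<x x+v≡u+y = diagonalMove′ k x≡ (+-cancelˡ-≡ u _ _ (begin
  u + y               ≡⟨ sym x+v≡u+y ⟩
  x + v               ≡⟨ cong (_+ v) x≡ ⟩
  u + suc k + v       ≡⟨ +-assoc u (suc k) v ⟩
  u + (suc k + v)     ≡⟨ cong (u +_) (+-comm (suc k) v) ⟩
  u + (v + suc k)     ∎))
  where
  open ≡-Reasoning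
  k : ℕ
  k = x ∸ suc u
  x≡ : x ≡ u + suc k
  x≡ = trans (sym (m+[n∸m]≡n u<x)) (sym (+-suc u k))

Aligned⇒Move : ∀ d {x y u v} → Large (x , y) → Small (u , v) → Aligned d (x , y) (u , v) → Move (x , y) (u , v)
Aligned⇒Move row      (inj₁ 8≤x) (u<8 , _)   refl = rowMove (<-≤-trans u<8 8≤x)
Aligned⇒Move row      (inj₂ 8≤y) (_ , y<8)   refl = contradiction 8≤y (<⇒≱ y<8)
Aligned⇒Move column   (inj₁ 8≤x) (x<8 , _)   refl = contradiction 8≤x (<⇒≱ x<8)
Aligned⇒Move column   (inj₂ 8≤y) (_ , v<8)   refl = columnMove (<-≤-trans v<8 8≤y)
Aligned⇒Move diagonal (inj₁ 8≤x) (u<8 , _)   x+v≡u+y = diagonalMove-from-left (<-≤-trans u<8 8≤x) x+v≡u+y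
Aligned⇒Move diagonal {x} {y} {u} {v} (inj₂ 8≤y) (_ , v<8) x+v≡u+y =
  Move-swap (diagonalMove-from-left (<-≤-trans v<8 8≤y) (trans (+-comm y u) (trans (sym x+v≡u+y) (+-comm x v))))

box : List Pos
box = cartesianProduct (upTo 8) (upTo 8)

Small⇒∈box : ∀ {p} → Small p → p ∈ box
Small⇒∈box (x<8 , y<8) = ∈-cartesianProduct⁺ (∈-upTo⁺ x<8) (∈-upTo⁺ y<8)

∈box⇒Small : ∀ {p} → p ∈ box → Small p
∈box⇒Small p∈ = let x∈ , y∈ = ∈-cartesianProduct⁻ (upTo 8) (upTo 8) p∈ in ∈-upTo⁻ x∈ , ∈-upTo⁻ y∈

isWythoffP? : ∀ q → Dec (wythoffP q ≡ true)
isWythoffP? q = wythoffP q Bool.≟ true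

smallWythoffP : List Pos
smallWythoffP = filter isWythoffP? box

∈smallWythoffP⁻ : ∀ {q} → q ∈ smallWythoffP → Small q × wythoffP q ≡ true
∈smallWythoffP⁻ q∈ = let q∈box , wq = ∈-filter⁻ isWythoffP? q∈ in ∈box⇒Small q∈box , wq

∈smallWythoffP⁺ : ∀ {q} → Small q → wythoffP q ≡ true → q ∈ smallWythoffP
∈smallWythoffP⁺ small wq = ∈-filter⁺ isWythoffP? (Small⇒∈box small) wq

-- Found by computation; variantOne-recursion-box certifies it.
smallVariantOne : List Pos
smallVariantOne = (0 , 3) ∷ (3 , 0) ∷ (1 , 2) ∷ (2 , 1) ∷ (4 , 4) ∷ (5 , 7) ∷ (7 , 5) ∷ []

variantOne : Pos → Bool
variantOne p = if does (small? p) then does (p ∈? smallVariantOne) else wythoffP p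

variantOne-large : ∀ {p} → Large p → variantOne p ≡ wythoffP p
variantOne-large {p} large =
  cong (λ b → if b then does (p ∈? smallVariantOne) else wythoffP p) (dec-false (small? p) (Large⇒¬Small large))

variantOne-small : ∀ {p} → Small p → variantOne p ≡ does (p ∈? smallVariantOne)
variantOne-small {p} small =
  cong (λ b → if b then does (p ∈? smallVariantOne) else wythoffP p) (dec-true (small? p) small)

LinesMeet : List Pos → List Pos → Set
LinesMeet A B = ∀ d → All (λ q → Any (Aligned d q) B) A

linesMeet? : ∀ A B d → Dec (All (λ q → Any (Aligned d q) B) A)
linesMeet? A B d = all? (λ q → any? (aligned? d q) B) A

variantOne-lines-meet-wythoffP : LinesMeet smallVariantOne smallWythoffP
variantOne-lines-meet-wythoffP row      = from-yes (linesMeet? smallVariantOne smallWythoffP row)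
variantOne-lines-meet-wythoffP column   = from-yes (linesMeet? smallVariantOne smallWythoffP column)
variantOne-lines-meet-wythoffP diagonal = from-yes (linesMeet? smallVariantOne smallWythoffP diagonal)

wythoffP-lines-meet-variantOne : LinesMeet smallWythoffP smallVariantOne
wythoffP-lines-meet-variantOne row      = from-yes (linesMeet? smallWythoffP smallVariantOne row)
wythoffP-lines-meet-variantOne column   = from-yes (linesMeet? smallWythoffP smallVariantOne column)
wythoffP-lines-meet-variantOne diagonal = from-yes (linesMeet? smallWythoffP smallVariantOne diagonal)

smallVariantOne-small : All Small smallVariantOne
smallVariantOne-small = from-yes (all? small? smallVariantOne)

VariantOneRecursion : Pos → Set
VariantOneRecursion (x , y) = variantOne (x , y) ≡ not (variantP (x , y)) ∧ allᵇ (not ∘ variantOne) (queenMoves x y)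

variantOne-recursion-box : All VariantOneRecursion box
variantOne-recursion-box = from-yes (all? recursion? box)
  where
  recursion? : ∀ p → Dec (VariantOneRecursion p)
  recursion? (x , y) = variantOne (x , y) Bool.≟ not (variantP (x , y)) ∧ allᵇ (not ∘ variantOne) (queenMoves x y)

wythoffP-partner : ∀ {x y q} → Large (x , y) → Move (x , y) q → q ∈ smallVariantOne →
                   ∃[ q′ ] Move (x , y) q′ × wythoffP q′ ≡ true
wythoffP-partner large mv q∈ with Move⇒Aligned mv
... | d , al with find (All.lookup (variantOne-lines-meet-wythoffP d) q∈)
...   | q′ , q′∈ , al′ =
  let small , wq′ = ∈smallWythoffP⁻ q′∈ in q′ , Aligned⇒Move d large small (Aligned-trans d al al′) , wq′

variantOne-partner : ∀ {x y q} → Large (x , y) → Move (x , y) q → q ∈ smallWythoffP →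
                     ∃[ q′ ] Move (x , y) q′ × variantOne q′ ≡ true
variantOne-partner large mv q∈ with Move⇒Aligned mv
... | d , al with find (All.lookup (wythoffP-lines-meet-variantOne d) q∈)
...   | q′ , q′∈ , al′ = q′ , Aligned⇒Move d large small (Aligned-trans d al al′) ,
                         trans (variantOne-small small) (dec-true (_ ∈? smallVariantOne) q′∈)
  where
  small : Small q′
  small = All.lookup smallVariantOne-small q′∈

variantOne-recursion-large : ∀ {x y} → Large (x , y) → VariantOneRecursion (x , y)
variantOne-recursion-large {x} {y} large with wythoffP (x , y) Bool.≟ true
... | yes w = begin
  variantOne (x , y)                                                  ≡⟨ variantOne-large large ⟩
  wythoffP (x , y)                                                    ≡⟨ w ⟩
  not false ∧ true
    ≡⟨ cong₂ _∧_ (cong not ¬variantP) (allMoves-true⁺ x y no-one) ⟨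
  not (variantP (x , y)) ∧ allᵇ (not ∘ variantOne) (queenMoves x y)   ∎
  where
  open ≡-Reasoning
  ¬variantP : variantP (x , y) ≡ false
  ¬variantP = large-wythoffP⇒¬variantP large w
  no-one : ∀ {q} → Move (x , y) q → not (variantOne q) ≡ true
  no-one {q} mv with small? q
  ... | no ¬small = cong not (trans (variantOne-large (¬Small⇒Large ¬small)) (wythoffP-independent w mv))
  ... | yes small = cong not (trans (variantOne-small small) (dec-false (q ∈? smallVariantOne) λ q∈ →
          let _ , mv′ , wq′ = wythoffP-partner large mv q∈ in
          contradiction (trans (sym wq′) (wythoffP-independent w mv′)) λ ()))
... | no ¬w = begin
  variantOne (x , y)                                                  ≡⟨ variantOne-large large ⟩
  wythoffP (x , y)                                                    ≡⟨ ¬-not ¬w ⟩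
  false                                                               ≡⟨ ∧-zeroʳ _ ⟨
  not (variantP (x , y)) ∧ false                                      ≡⟨ cong (not (variantP (x , y)) ∧_) some-one ⟨
  not (variantP (x , y)) ∧ allᵇ (not ∘ variantOne) (queenMoves x y)   ∎
  where
  open ≡-Reasoning
  some-one : allᵇ (not ∘ variantOne) (queenMoves x y) ≡ false
  some-one with wythoffP-absorbing (¬-not ¬w)
  ... | q , mv , wq with small? q
  ...   | no ¬small = allMoves-false⁺ x y mv (cong not (trans (variantOne-large (¬Small⇒Large ¬small)) wq))
  ...   | yes small = let _ , mv′ , oq′ = variantOne-partner large mv (∈smallWythoffP⁺ small wq) in
                      allMoves-false⁺ x y mv′ (cong not oq′)

variantOne-recursion : ∀ p → VariantOneRecursion p
variantOne-recursion (x , y) with small? (x , y)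
... | yes small = All.lookup variantOne-recursion-box (Small⇒∈box small)
... | no ¬small = variantOne-recursion-large (¬Small⇒Large ¬small)

<⇒≡ᵇ-false : ∀ {m n} → m < n → (m ≡ᵇ n) ≡ false
<⇒≡ᵇ-false {zero}  {suc n} _         = refl
<⇒≡ᵇ-false {suc m} {suc n} (s≤s m<n) = <⇒≡ᵇ-false m<n

≡ᵇ-true⇔≡ : ∀ m n → (m ≡ᵇ n) ≡ true ⇔ m ≡ n
≡ᵇ-true⇔≡ m n = mk⇔ (≡ᵇ⇒≡ m n ∘ Equivalence.from T-≡) (Equivalence.to T-≡ ∘ ≡⇒≡ᵇ m n)

mexFrom-≥ : ∀ f k l → k ≤ mexFrom f k l
mexFrom-≥ zero    k l = ≤-refl
mexFrom-≥ (suc f) k l with elemᵇ k l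
... | true  = ≤-trans (n≤1+n k) (mexFrom-≥ f (suc k) l)
... | false = ≤-refl

mex≡0 : ∀ l → (0 ≡ᵇ mex l) ≡ not (elemᵇ 0 l)
mex≡0 l with elemᵇ 0 l
... | true  = <⇒≡ᵇ-false (mexFrom-≥ (length l) 1 l)
... | false = refl

mex≡1 : ∀ l → (1 ≡ᵇ mex l) ≡ elemᵇ 0 l ∧ not (elemᵇ 1 l)
mex≡1 []           = refl
mex≡1 l@(_ ∷ l′) with elemᵇ 0 l
... | false = refl
... | true with elemᵇ 1 l
...   | true  = <⇒≡ᵇ-false (mexFrom-≥ (length l′) 2 l)
...   | false = refl

elemᵇ-map : ∀ {A : Set} k (g : A → ℕ) l → elemᵇ k (map g l) ≡ not (allᵇ (λ a → not (k ≡ᵇ g a)) l)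
elemᵇ-map k g []      = refl
elemᵇ-map k g (a ∷ l) with k ≡ᵇ g a
... | true  = refl
... | false = elemᵇ-map k g l

variantP-terminal : ∀ x y → x + y ≤ 2 → variantP (x , y) ≡ true
variantP-terminal x y term = dec-true (Variant.pPosition? (x , y)) (inj₁ term)

variantMoves-terminal : ∀ x y → x + y ≤ 2 → variantMoves x y ≡ []
variantMoves-terminal x y term = cong (λ b → if b then [] else queenMoves x y) (dec-true (x + y ≤? 2) term)

variantMoves-nonterminal : ∀ x y → ¬ x + y ≤ 2 → variantMoves x y ≡ queenMoves x y
variantMoves-nonterminal x y ¬term = cong (λ b → if b then [] else queenMoves x y) (dec-false (x + y ≤? 2) ¬term)

GrundyMatches : ℕ → Pos → Set
GrundyMatches n p = (0 ≡ᵇ n) ≡ variantP p × (1 ≡ᵇ n) ≡ variantOne p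

grundy-step : ∀ (g : Pos → ℕ) x y → (∀ {q} → Move (x , y) q → GrundyMatches (g q) q) →
              GrundyMatches (mex (map g (variantMoves x y))) (x , y)
grundy-step g x y ih with x + y ≤? 2
... | yes term = subst (λ l → GrundyMatches (mex (map g l)) (x , y)) (sym (variantMoves-terminal x y term))
                   (sym (variantP-terminal x y term) , sym one≡false)
  where
  one≡false : variantOne (x , y) ≡ false
  one≡false = trans (variantOne-recursion (x , y))
                (cong (λ b → not b ∧ allᵇ (not ∘ variantOne) (queenMoves x y)) (variantP-terminal x y term))
... | no ¬term = subst (λ l → GrundyMatches (mex (map g l)) (x , y)) (sym (variantMoves-nonterminal x y ¬term))
                   (zero-matches , one-matches)
  where
  open ≡-Reasoning
  moves : List Pos
  moves = queenMoves x y
  no-zero : allᵇ (λ q → not (0 ≡ᵇ g q)) moves ≡ variantP (x , y)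
  no-zero = trans (allMoves-cong x y (cong not ∘ proj₁ ∘ ih)) (sym (Variant.isP-kernel x y ¬term))
  no-one : allᵇ (λ q → not (1 ≡ᵇ g q)) moves ≡ allᵇ (not ∘ variantOne) moves
  no-one = allMoves-cong x y (cong not ∘ proj₂ ∘ ih)
  zero-matches : (0 ≡ᵇ mex (map g moves)) ≡ variantP (x , y)
  zero-matches = begin
    (0 ≡ᵇ mex (map g moves))                          ≡⟨ mex≡0 (map g moves) ⟩
    not (elemᵇ 0 (map g moves))                       ≡⟨ cong not (elemᵇ-map 0 g moves) ⟩
    not (not (allᵇ (λ q → not (0 ≡ᵇ g q)) moves))     ≡⟨ not-involutive _ ⟩
    allᵇ (λ q → not (0 ≡ᵇ g q)) moves                 ≡⟨ no-zero ⟩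
    variantP (x , y)                                  ∎
  one-matches : (1 ≡ᵇ mex (map g moves)) ≡ variantOne (x , y)
  one-matches = begin
    (1 ≡ᵇ mex (map g moves))                                   ≡⟨ mex≡1 (map g moves) ⟩
    elemᵇ 0 (map g moves) ∧ not (elemᵇ 1 (map g moves))
      ≡⟨ cong₂ (λ a b → a ∧ not b) (elemᵇ-map 0 g moves) (elemᵇ-map 1 g moves) ⟩
    not (allᵇ (λ q → not (0 ≡ᵇ g q)) moves)
      ∧ not (not (allᵇ (λ q → not (1 ≡ᵇ g q)) moves))
      ≡⟨ cong₂ (λ a b → not a ∧ b) no-zero (trans (not-involutive _) no-one) ⟩
    not (variantP (x , y)) ∧ allᵇ (not ∘ variantOne) moves     ≡⟨ variantOne-recursion (x , y) ⟨
    variantOne (x , y)                                         ∎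

grundyF-matches : ∀ f x y → x + y < f → GrundyMatches (grundyF f x y) (x , y)
grundyF-matches (suc f) x y x+y<1+f =
  grundy-step _ x y λ {(u , v)} mv → grundyF-matches f u v (<-≤-trans (Move-sum-< mv) (≤-pred x+y<1+f))

theorem6p9 : (x y : ℕ) → (8 ≤ x ⊎ 8 ≤ y) → (variantGrundy x y ≡ 1 ⇔ isWythoffP x y ≡ true)
theorem6p9 x y large = mk⇔
  (λ G≡1 → trans (sym one≡wythoff) (Equivalence.from (≡ᵇ-true⇔≡ 1 _) (sym G≡1)))
  (λ w → sym (Equivalence.to (≡ᵇ-true⇔≡ 1 _) (trans one≡wythoff w)))
  where
  open ≡-Reasoning
  one≡wythoff : (1 ≡ᵇ variantGrundy x y) ≡ isWythoffP x y
  one≡wythoff = begin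
    (1 ≡ᵇ variantGrundy x y)  ≡⟨ proj₂ (grundyF-matches (suc (x + y)) x y ≤-refl) ⟩
    variantOne (x , y)        ≡⟨ variantOne-large large ⟩
    wythoffP (x , y)          ≡⟨ isPF≡wythoffP (suc (x + y)) x y ≤-refl ⟨
    isWythoffP x y            ∎
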